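{- Let $G$ be a finite abelian group and $W \subseteq G$. If $C$ is a minimal complement for $W$, then $$|C| \leq |G| \frac{|W|}{2|W| - 1}.$$ In particular, if $C$ is a minimal complement for $W$ and $C \neq G$, then $|C| \leq 2|G|/3$.
   Context: $C \subseteq G$ is a complement for $W$ if $W + C = G$, where $W+C=\{w+c : w\in W, c\in C\}$; it is a minimal complement for $W$ if moreover no proper subset of $C$ is a complement for $W$. -}

module Defs where

open import Data.Nat using (ℕ)
open import Data.Fin using (Fin)
open import Data.Fin.Subset using (Subset; _∈_; _⊂_)
open import Data.Product using (Σ; ∃; _×_)
open import Relation.Nullary using (¬_)
open import Relation.Binary.PropositionalEquality using (_≡_)
open import Algebra.Core using (Op₂)

-- A finite abelian group of order n is represented (up to isomorphism)
-- by a group structure on Fin n with propositional equality; subsets of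
-- G are Data.Fin.Subset n, and |·| is Data.Fin.Subset.∣_∣.

IsComplement : ∀ {n} → Op₂ (Fin n) → Subset n → Subset n → Set
IsComplement {n} _+_ W C =
  ∀ (g : Fin n) → ∃ λ (w : Fin n) → ∃ λ (c : Fin n) →
    w ∈ W × c ∈ C × g ≡ w + c

IsMinimalComplement : ∀ {n} → Op₂ (Fin n) → Subset n → Subset n → Set
IsMinimalComplement {n} _+_ W C =
  IsComplement _+_ W C × (∀ (C' : Subset n) → C' ⊂ C → ¬ IsComplement _+_ W C')

-- For each c ∈ C, minimality gives some g_c ∈ G that lies in W + C only through c: of the
-- elements g_c − w (w ∈ W) exactly one lies in C. Count the pairs (c, w) ∈ C × W with
-- g_c − w ∉ C. Each c contributes at least |W| − 1 of them; for fixed w the map c ↦ g_c − w is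
-- injective on C (g_c determines c), so each w contributes at most |G ∖ C|. Hence
-- |C| (|W| − 1) ≤ |W| (|G| − |C|). If C ≠ G then |W| ≥ 2, since a one-element W has G as its
-- only complement, and for |W| ≥ 2 the bound gives |C| ≤ 2|G|/3.
module Submission where

open import Defs
open import Data.Nat using (ℕ; _*_; _∸_; _≤_)
open import Data.Fin using (Fin)
open import Data.Fin.Subset using (Subset; ∣_∣; ⊤)
open import Data.Product using (_×_)
open import Relation.Nullary using (¬_)
open import Relation.Binary.PropositionalEquality using (_≡_)
open import Algebra.Core using (Op₁; Op₂)
open import Algebra.Structures using (IsAbelianGroup)

open import Algebra.Bundles using (Group)
open import Algebra.Structures using (IsGroup)
open import Level using (0ℓ)
open import Data.Bool.Base using (true; false; if_then_else_)
open import Data.Fin.Base using (zero; suc)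
open import Data.Fin.Properties using (any?; ¬∀⟶∃¬; suc-injective) renaming (_≟_ to _≟ᶠ_)
open import Data.Fin.Subset using (_∈_; _∉_; _─_; ∁; ⁅_⁆; ⊥)
open import Data.Fin.Subset.Properties
  using (_∈?_; ∉⊥; ∈⊤; ⊆-antisym; x∈⁅y⁆⇒x≡y; x∈p⇒x∉∁p; x∉p⇒x∈∁p;
         x∈p⇒p-x⊂p; x∈p∧x≢y⇒x∈p-y; x∈p⇒∣p-x∣<∣p∣; ∣∁p∣≡n∸∣p∣; ∣p∣≤n)
open import Data.Nat.Base using (zero; suc; _+_; _<_; z≤n; s≤s)
open import Data.Nat.Properties
  using (_≟_; ≤-refl; ≤-reflexive; ≤-trans; ≤-<-trans; <⇒≱; ≰⇒>; 1+n≢0; n≤1⇒n≡0∨n≡1;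
         +-identityʳ; *-identityˡ; *-identityʳ; *-zeroʳ; *-assoc; *-distribˡ-+; *-distribˡ-∸;
         m≤m+n; m+n∸n≡m; m+[n∸m]≡n; +-mono-≤; +-monoˡ-≤; +-monoʳ-≤; *-mono-≤; *-monoˡ-≤;
         *-monoʳ-≤; *-cancelʳ-≤; ∸-monoˡ-≤; module ≤-Reasoning;
         +-0-commutativeMonoid; +-*-semiring; *-commutativeSemigroup)
open import Data.Nat.Tactic.RingSolver using (solve-∀)
open import Data.Product using (∃; _,_; proj₁; proj₂)
open import Data.Sum using (inj₁; inj₂)
open import Data.Vec using ([]; _∷_; lookup)
open import Data.Vec.Properties using ([]=⇒lookup; lookup⇒[]=)
open import Function.Base using (_∘_)
open import Relation.Nullary using (Dec; yes; no; contradiction)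
open import Relation.Nullary.Decidable using (_×-dec_)
open import Relation.Binary.PropositionalEquality using (_≢_; refl; sym; trans; cong; cong₂; subst)

open import Algebra.Properties.CommutativeMonoid.Sum +-0-commutativeMonoid
  using (sum; sum-cong-≗; sum-replicate-zero; ∑-comm; ∑-distrib-+)
open import Algebra.Properties.Semiring.Sum +-*-semiring
  using (*-distribˡ-sum; *-distribʳ-sum)
open import Algebra.Properties.CommutativeSemigroup *-commutativeSemigroup
  using (x∙yz≈y∙xz)

private
  variable
    m n : ℕ
    x y : Fin n
    p : Subset n

sum-mono-≤ : {f g : Fin n → ℕ} → (∀ i → f i ≤ g i) → sum f ≤ sum g
sum-mono-≤ {zero}  f≤g = z≤n
sum-mono-≤ {suc n} f≤g = +-mono-≤ (f≤g zero) (sum-mono-≤ (f≤g ∘ suc))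

sum-≤1 : (f : Fin n → ℕ) → (∀ i → f i ≤ 1) →
         (∀ {i j} → f i ≢ 0 → f j ≢ 0 → i ≡ j) → sum f ≤ 1
sum-≤1 {zero}  f f≤1 unique = z≤n
sum-≤1 {suc n} f f≤1 unique with n≤1⇒n≡0∨n≡1 (f≤1 zero)
... | inj₁ f₀≡0 = ≤-trans (≤-reflexive (cong (_+ sum (f ∘ suc)) f₀≡0))
    (sum-≤1 (f ∘ suc) (f≤1 ∘ suc) (λ fi≢0 fj≢0 → suc-injective (unique fi≢0 fj≢0)))
... | inj₂ f₀≡1 = ≤-reflexive (cong₂ _+_ f₀≡1 (trans (sum-cong-≗ tail≡0) (sum-replicate-zero n)))
  where
  tail≡0 : ∀ i → f (suc i) ≡ 0
  tail≡0 i with f (suc i) ≟ 0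
  ... | yes fi≡0 = fi≡0
  ... | no  fi≢0 = contradiction (unique f₀≢0 fi≢0) λ ()
    where
    f₀≢0 : f zero ≢ 0
    f₀≢0 f₀≡0 = 1+n≢0 (trans (sym f₀≡1) f₀≡0)

𝟙 : Subset n → Fin n → ℕ
𝟙 p x = if lookup p x then 1 else 0

𝟙-∈ : x ∈ p → 𝟙 p x ≡ 1
𝟙-∈ x∈p rewrite []=⇒lookup x∈p = refl

𝟙-∉ : x ∉ p → 𝟙 p x ≡ 0
𝟙-∉ {x = x} {p = p} x∉p with lookup p x in eq
... | true  = contradiction (lookup⇒[]= x p eq) x∉p
... | false = refl

𝟙≤1 : ∀ (p : Subset n) x → 𝟙 p x ≤ 1
𝟙≤1 p x with lookup p x
... | true  = ≤-refl
... | false = z≤n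

𝟙-mono-* : ∀ (p : Subset n) x {a b} → (x ∈ p → a ≤ b) → 𝟙 p x * a ≤ 𝟙 p x * b
𝟙-mono-* p x a≤b with x ∈? p
... | yes x∈p = *-monoʳ-≤ (𝟙 p x) (a≤b x∈p)
... | no  x∉p rewrite 𝟙-∉ x∉p = z≤n

𝟙*𝟙≢0 : ∀ {q : Subset m} {y : Fin m} → 𝟙 p x * 𝟙 q y ≢ 0 → x ∈ p × y ∈ q
𝟙*𝟙≢0 {p = p} {x = x} {q = q} {y = y} ne with x ∈? p | y ∈? q
... | yes x∈p | yes y∈q = x∈p , y∈q
... | no  x∉p | _       = contradiction (cong (_* 𝟙 q y) (𝟙-∉ x∉p)) ne
... | yes _   | no  y∉q = contradiction (trans (cong (𝟙 p x *_) (𝟙-∉ y∉q)) (*-zeroʳ (𝟙 p x))) ne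

𝟙+𝟙∁≡1 : ∀ (p : Subset n) x → 𝟙 p x + 𝟙 (∁ p) x ≡ 1
𝟙+𝟙∁≡1 p x with x ∈? p
... | yes x∈p = cong₂ _+_ (𝟙-∈ x∈p) (𝟙-∉ (x∈p⇒x∉∁p x∈p))
... | no  x∉p = cong₂ _+_ (𝟙-∉ x∉p) (𝟙-∈ (x∉p⇒x∈∁p x∉p))

sum-𝟙≡∣∣ : ∀ (p : Subset n) → sum (𝟙 p) ≡ ∣ p ∣
sum-𝟙≡∣∣ []           = refl
sum-𝟙≡∣∣ (true  ∷ p) = cong suc (sum-𝟙≡∣∣ p)
sum-𝟙≡∣∣ (false ∷ p) = sum-𝟙≡∣∣ p

sum-𝟙⁅⁆* : ∀ (a : Fin n) (b : Fin n → ℕ) → sum (λ j → 𝟙 ⁅ a ⁆ j * b j) ≡ b a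
sum-𝟙⁅⁆* {suc n} zero    b = trans (cong₂ _+_ (+-identityʳ (b zero)) rest≡0) (+-identityʳ (b zero))
  where
  rest≡0 : sum (λ j → 𝟙 ⊥ j * b (suc j)) ≡ 0
  rest≡0 = trans (sum-cong-≗ (λ j → cong (_* b (suc j)) (𝟙-∉ {x = j} ∉⊥))) (sum-replicate-zero n)
sum-𝟙⁅⁆* {suc n} (suc a) b = sum-𝟙⁅⁆* a (b ∘ suc)

∣p∣+∣∁p∣≡n : ∀ (p : Subset n) → ∣ p ∣ + ∣ ∁ p ∣ ≡ n
∣p∣+∣∁p∣≡n p = trans (cong (∣ p ∣ +_) (∣∁p∣≡n∸∣p∣ p)) (m+[n∸m]≡n (∣p∣≤n p))

∣p∣≤1⇒subsingleton : ∣ p ∣ ≤ 1 → x ∈ p → y ∈ p → x ≡ y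
∣p∣≤1⇒subsingleton {p = p} {x = x} {y = y} ∣p∣≤1 x∈p y∈p with x ≟ᶠ y
... | yes x≡y = x≡y
... | no  x≢y = contradiction ∣p∣≤1 (<⇒≱ (≤-trans (s≤s 0<∣p-x∣) (x∈p⇒∣p-x∣<∣p∣ x∈p)))
  where
  0<∣p-x∣ : 0 < ∣ p ─ ⁅ x ⁆ ∣
  0<∣p-x∣ = ≤-<-trans z≤n (x∈p⇒∣p-x∣<∣p∣ (x∈p∧x≢y⇒x∈p-y y∈p (x≢y ∘ sym)))

sum-injective-≤ : ∀ (p : Subset m) (f : Fin m → Fin n) (b : Fin n → ℕ) →
                  (∀ {i j} → i ∈ p → j ∈ p → f i ≡ f j → i ≡ j) →
                  sum (λ i → 𝟙 p i * b (f i)) ≤ sum b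
sum-injective-≤ p f b f-injective = begin
  sum (λ i → 𝟙 p i * b (f i))
    ≡⟨ sum-cong-≗ (λ i → cong (𝟙 p i *_) (sym (sum-𝟙⁅⁆* (f i) b))) ⟩
  sum (λ i → 𝟙 p i * sum (λ j → 𝟙 ⁅ f i ⁆ j * b j))
    ≡⟨ sum-cong-≗ (λ i → *-distribˡ-sum (𝟙 p i) (λ j → 𝟙 ⁅ f i ⁆ j * b j)) ⟩
  sum (λ i → sum (λ j → 𝟙 p i * (𝟙 ⁅ f i ⁆ j * b j)))
    ≡⟨ ∑-comm (λ i j → 𝟙 p i * (𝟙 ⁅ f i ⁆ j * b j)) ⟩
  sum (λ j → sum (λ i → 𝟙 p i * (𝟙 ⁅ f i ⁆ j * b j)))
    ≡⟨ sum-cong-≗ (λ j → trans (sum-cong-≗ (λ i → sym (*-assoc (𝟙 p i) _ (b j))))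
                               (sym (*-distribʳ-sum (b j) (λ i → 𝟙 p i * 𝟙 ⁅ f i ⁆ j)))) ⟩
  sum (λ j → sum (λ i → 𝟙 p i * 𝟙 ⁅ f i ⁆ j) * b j)
    ≤⟨ sum-mono-≤ (λ j → *-monoˡ-≤ (b j) (fibre≤1 j)) ⟩
  sum (λ j → 1 * b j)
    ≡⟨ sum-cong-≗ (λ j → *-identityˡ (b j)) ⟩
  sum b ∎
  where
  open ≤-Reasoning
  fibre≤1 : ∀ j → sum (λ i → 𝟙 p i * 𝟙 ⁅ f i ⁆ j) ≤ 1
  fibre≤1 j = sum-≤1 _ (λ i → *-mono-≤ (𝟙≤1 p i) (𝟙≤1 ⁅ f i ⁆ j)) same-fibre
    where
    same-fibre : ∀ {i i′} → 𝟙 p i * 𝟙 ⁅ f i ⁆ j ≢ 0 → 𝟙 p i′ * 𝟙 ⁅ f i′ ⁆ j ≢ 0 → i ≡ i′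
    same-fibre {i} {i′} ne ne′ with 𝟙*𝟙≢0 ne | 𝟙*𝟙≢0 ne′
    ... | i∈p , j∈fi | i′∈p , j∈fi′ =
      f-injective i∈p i′∈p (trans (sym (x∈⁅y⁆⇒x≡y (f i) j∈fi)) (x∈⁅y⁆⇒x≡y (f i′) j∈fi′))

module _ (_∙_ : Op₂ (Fin n)) (W : Subset n) where

  Covered : Subset n → Fin n → Set
  Covered C g = ∃ λ w → ∃ λ c → w ∈ W × c ∈ C × g ≡ w ∙ c

  covered? : ∀ C g → Dec (Covered C g)
  covered? C g = any? λ w → any? λ c → w ∈? W ×-dec c ∈? C ×-dec g ≟ᶠ w ∙ c

  PrivatelyCovers : Subset n → Fin n → Fin n → Set
  PrivatelyCovers C c g = ∀ {w c′} → w ∈ W → c′ ∈ C → g ≡ w ∙ c′ → c′ ≡ c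

  minimal⇒private : ∀ {C c} → IsMinimalComplement _∙_ W C → c ∈ C → ∃ (PrivatelyCovers C c)
  minimal⇒private {C} {c} (_ , minimal) c∈C = g , g-private
    where
    uncovered : ∃ λ g → ¬ Covered (C ─ ⁅ c ⁆) g
    uncovered = ¬∀⟶∃¬ n (Covered (C ─ ⁅ c ⁆)) (covered? (C ─ ⁅ c ⁆))
                      (minimal (C ─ ⁅ c ⁆) (x∈p⇒p-x⊂p c∈C))
    g : Fin n
    g = proj₁ uncovered
    g-private : PrivatelyCovers C c g
    g-private {c′ = c′} w∈W c′∈C g≡w∙c′ with c′ ≟ᶠ c
    ... | yes c′≡c = c′≡c
    ... | no  c′≢c =
      contradiction (_ , _ , w∈W , x∈p∧x≢y⇒x∈p-y c′∈C c′≢c , g≡w∙c′) (proj₂ uncovered)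

module _ {_∙_ : Op₂ (Fin n)} {ε : Fin n} {_⁻¹ : Op₁ (Fin n)}
         (isAbelianGroup : IsAbelianGroup _≡_ _∙_ ε _⁻¹) where

  open IsAbelianGroup isAbelianGroup using (isGroup; comm)
  open IsGroup isGroup using (_//_)

  group : Group 0ℓ 0ℓ
  group = record { isGroup = isGroup }

  open import Algebra.Properties.Group group
    using (//-rightDividesˡ; ∙-cancelˡ; ∙-cancelʳ; ⁻¹-injective)

  x≡y∙[x//y] : ∀ x y → x ≡ y ∙ (x // y)
  x≡y∙[x//y] x y = sym (trans (comm y (x // y)) (//-rightDividesˡ y x))

  //-cancelˡ : ∀ x {y z} → x // y ≡ x // z → y ≡ z
  //-cancelˡ x eq = ⁻¹-injective (∙-cancelˡ x _ _ eq)

  //-cancelʳ : ∀ z {x y} → x // z ≡ y // z → x ≡ y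
  //-cancelʳ z = ∙-cancelʳ (z ⁻¹) _ _

  complement-of-subsingleton : ∀ {W C} → IsComplement _∙_ W C →
                               (∀ {w w′} → w ∈ W → w′ ∈ W → w ≡ w′) → C ≡ ⊤
  complement-of-subsingleton {W} {C} complement subsingleton with complement ε
  ... | w₀ , _ , w₀∈W , _ = ⊆-antisym (λ _ → ∈⊤) ⊤⊆C
    where
    ⊤⊆C : ∀ {x} → x ∈ ⊤ → x ∈ C
    ⊤⊆C {x} _ with complement (w₀ ∙ x)
    ... | w , c , w∈W , c∈C , w₀∙x≡w∙c =
      subst (_∈ C) (sym (∙-cancelˡ w₀ x c (trans w₀∙x≡w∙c (cong (_∙ c) (subsingleton w∈W w₀∈W)))))
            c∈C

  module _ {W C : Subset n} (minimal : IsMinimalComplement _∙_ W C) where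

    private-witness : ∀ c → ∃ λ g → c ∈ C → PrivatelyCovers _∙_ W C c g
    private-witness c with c ∈? C
    ... | yes c∈C = let g , g-private = minimal⇒private _∙_ W minimal c∈C in g , λ _ → g-private
    ... | no  c∉C = c , λ c∈C → contradiction c∈C c∉C

    witness : Fin n → Fin n
    witness c = proj₁ (private-witness c)

    witness-private : ∀ {c} → c ∈ C → PrivatelyCovers _∙_ W C c (witness c)
    witness-private {c} = proj₂ (private-witness c)

    witness-injective : ∀ {c c′} → c ∈ C → c′ ∈ C → witness c ≡ witness c′ → c ≡ c′
    witness-injective {c} c∈C c′∈C eq with proj₁ minimal (witness c)
    ... | w , d , w∈W , d∈C , g≡w∙d =
      trans (sym (witness-private c∈C w∈W d∈C g≡w∙d))
            (witness-private c′∈C w∈W d∈C (trans (sym eq) g≡w∙d))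

    representations≤1 : ∀ {c} → c ∈ C → sum (λ w → 𝟙 W w * 𝟙 C (witness c // w)) ≤ 1
    representations≤1 {c} c∈C = sum-≤1 _ (λ w → *-mono-≤ (𝟙≤1 W w) (𝟙≤1 C _)) unique
      where
      g : Fin n
      g = witness c
      forced : ∀ w → 𝟙 W w * 𝟙 C (g // w) ≢ 0 → g // w ≡ c
      forced w ne with 𝟙*𝟙≢0 ne
      ... | w∈W , g//w∈C = witness-private c∈C w∈W g//w∈C (x≡y∙[x//y] g w)
      unique : ∀ {w w′} → 𝟙 W w * 𝟙 C (g // w) ≢ 0 → 𝟙 W w′ * 𝟙 C (g // w′) ≢ 0 → w ≡ w′
      unique {w} {w′} ne ne′ = //-cancelˡ g (trans (forced w ne) (sym (forced w′ ne′)))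

    outside : Fin n → ℕ
    outside c = sum (λ w → 𝟙 W w * 𝟙 (∁ C) (witness c // w))

    ∣W∣≤1+outside : ∀ {c} → c ∈ C → ∣ W ∣ ≤ 1 + outside c
    ∣W∣≤1+outside {c} c∈C = begin
      ∣ W ∣
        ≡⟨ sym (sum-𝟙≡∣∣ W) ⟩
      sum (𝟙 W)
        ≡⟨ sum-cong-≗ split ⟩
      sum (λ w → 𝟙 W w * 𝟙 C (g // w) + 𝟙 W w * 𝟙 (∁ C) (g // w))
        ≡⟨ ∑-distrib-+ (λ w → 𝟙 W w * 𝟙 C (g // w)) (λ w → 𝟙 W w * 𝟙 (∁ C) (g // w)) ⟩
      sum (λ w → 𝟙 W w * 𝟙 C (g // w)) + outside c
        ≤⟨ +-monoˡ-≤ (outside c) (representations≤1 c∈C) ⟩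
      1 + outside c ∎
      where
      open ≤-Reasoning
      g : Fin n
      g = witness c
      split : ∀ w → 𝟙 W w ≡ 𝟙 W w * 𝟙 C (g // w) + 𝟙 W w * 𝟙 (∁ C) (g // w)
      split w = trans (sym (*-identityʳ (𝟙 W w)))
        (trans (cong (𝟙 W w *_) (sym (𝟙+𝟙∁≡1 C (g // w)))) (*-distribˡ-+ (𝟙 W w) _ _))

    outsidePairs : ℕ
    outsidePairs = sum (λ c → 𝟙 C c * outside c)

    ∣C∣*∣W∣≤∣C∣+outsidePairs : ∣ C ∣ * ∣ W ∣ ≤ ∣ C ∣ + outsidePairs
    ∣C∣*∣W∣≤∣C∣+outsidePairs = begin
      ∣ C ∣ * ∣ W ∣
        ≡⟨ cong (_* ∣ W ∣) (sym (sum-𝟙≡∣∣ C)) ⟩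
      sum (𝟙 C) * ∣ W ∣
        ≡⟨ *-distribʳ-sum ∣ W ∣ (𝟙 C) ⟩
      sum (λ c → 𝟙 C c * ∣ W ∣)
        ≤⟨ sum-mono-≤ (λ c → 𝟙-mono-* C c ∣W∣≤1+outside) ⟩
      sum (λ c → 𝟙 C c * (1 + outside c))
        ≡⟨ sum-cong-≗ (λ c → trans (*-distribˡ-+ (𝟙 C c) 1 (outside c))
                                   (cong (_+ 𝟙 C c * outside c) (*-identityʳ (𝟙 C c)))) ⟩
      sum (λ c → 𝟙 C c + 𝟙 C c * outside c)
        ≡⟨ ∑-distrib-+ (𝟙 C) (λ c → 𝟙 C c * outside c) ⟩
      sum (𝟙 C) + outsidePairs
        ≡⟨ cong (_+ outsidePairs) (sum-𝟙≡∣∣ C) ⟩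
      ∣ C ∣ + outsidePairs ∎
      where open ≤-Reasoning

    outsidePairs≤∣W∣*∣∁C∣ : outsidePairs ≤ ∣ W ∣ * ∣ ∁ C ∣
    outsidePairs≤∣W∣*∣∁C∣ = begin
      sum (λ c → 𝟙 C c * sum (λ w → 𝟙 W w * X c w))
        ≡⟨ sum-cong-≗ (λ c → *-distribˡ-sum (𝟙 C c) (λ w → 𝟙 W w * X c w)) ⟩
      sum (λ c → sum (λ w → 𝟙 C c * (𝟙 W w * X c w)))
        ≡⟨ ∑-comm (λ c w → 𝟙 C c * (𝟙 W w * X c w)) ⟩
      sum (λ w → sum (λ c → 𝟙 C c * (𝟙 W w * X c w)))
        ≡⟨ sum-cong-≗ (λ w → trans (sum-cong-≗ (λ c → x∙yz≈y∙xz (𝟙 C c) (𝟙 W w) (X c w)))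
                                   (sym (*-distribˡ-sum (𝟙 W w) (λ c → 𝟙 C c * X c w)))) ⟩
      sum (λ w → 𝟙 W w * sum (λ c → 𝟙 C c * X c w))
        ≤⟨ sum-mono-≤ (λ w → *-monoʳ-≤ (𝟙 W w) (fibre≤∣∁C∣ w)) ⟩
      sum (λ w → 𝟙 W w * ∣ ∁ C ∣)
        ≡⟨ sym (*-distribʳ-sum ∣ ∁ C ∣ (𝟙 W)) ⟩
      sum (𝟙 W) * ∣ ∁ C ∣
        ≡⟨ cong (_* ∣ ∁ C ∣) (sum-𝟙≡∣∣ W) ⟩
      ∣ W ∣ * ∣ ∁ C ∣ ∎
      where
      open ≤-Reasoning
      X : Fin n → Fin n → ℕ
      X c w = 𝟙 (∁ C) (witness c // w)
      fibre≤∣∁C∣ : ∀ w → sum (λ c → 𝟙 C c * X c w) ≤ ∣ ∁ C ∣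
      fibre≤∣∁C∣ w = ≤-trans
        (sum-injective-≤ C (λ c → witness c // w) (𝟙 (∁ C))
          (λ c∈C c′∈C eq → witness-injective c∈C c′∈C (//-cancelʳ w eq)))
        (≤-reflexive (sum-𝟙≡∣∣ (∁ C)))

    ∣C∣*∣W∣≤∣C∣+∣W∣*∣∁C∣ : ∣ C ∣ * ∣ W ∣ ≤ ∣ C ∣ + ∣ W ∣ * ∣ ∁ C ∣
    ∣C∣*∣W∣≤∣C∣+∣W∣*∣∁C∣ =
      ≤-trans ∣C∣*∣W∣≤∣C∣+outsidePairs (+-monoʳ-≤ ∣ C ∣ outsidePairs≤∣W∣*∣∁C∣)

m*k≤m+k*l⇒m*[2k∸1]≤[m+l]*k : ∀ m k l → m * k ≤ m + k * l → m * (2 * k ∸ 1) ≤ (m + l) * k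
m*k≤m+k*l⇒m*[2k∸1]≤[m+l]*k m k l m*k≤m+k*l = begin
  m * (2 * k ∸ 1)       ≡⟨ *-distribˡ-∸ m (2 * k) 1 ⟩
  m * (2 * k) ∸ m * 1   ≡⟨ cong (m * (2 * k) ∸_) (*-identityʳ m) ⟩
  m * (2 * k) ∸ m       ≤⟨ ∸-monoˡ-≤ m 2mk≤[m+l]k+m ⟩
  (m + l) * k + m ∸ m   ≡⟨ m+n∸n≡m ((m + l) * k) m ⟩
  (m + l) * k           ∎
  where
  open ≤-Reasoning
  2mk≤[m+l]k+m : m * (2 * k) ≤ (m + l) * k + m
  2mk≤[m+l]k+m = begin
    m * (2 * k)             ≡⟨ double m k ⟩
    m * k + m * k           ≤⟨ +-monoʳ-≤ (m * k) m*k≤m+k*l ⟩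
    m * k + (m + k * l)     ≡⟨ regroup m k l ⟩
    (m + l) * k + m         ∎
    where
    double : ∀ m k → m * (2 * k) ≡ m * k + m * k
    double = solve-∀
    regroup : ∀ m k l → m * k + (m + k * l) ≡ (m + l) * k + m
    regroup = solve-∀

2≤k⇒m*[2k∸1]≤n*k⇒3m≤2n : ∀ m n k → 2 ≤ k → m * (2 * k ∸ 1) ≤ n * k → 3 * m ≤ 2 * n
2≤k⇒m*[2k∸1]≤n*k⇒3m≤2n m n (suc (suc j)) (s≤s (s≤s _)) m*[2k∸1]≤n*k =
  *-cancelʳ-≤ (3 * m) (2 * n) (3 + 2 * j) (begin
  3 * m * (3 + 2 * j)                  ≡⟨ *-assoc 3 m (3 + 2 * j) ⟩
  3 * (m * (4 + 2 * j ∸ 1))            ≡⟨ cong (λ t → 3 * (m * (t ∸ 1))) (sym (double+ j)) ⟩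
  3 * (m * (2 * (2 + j) ∸ 1))          ≤⟨ *-monoʳ-≤ 3 m*[2k∸1]≤n*k ⟩
  3 * (n * (2 + j))                    ≤⟨ m≤m+n (3 * (n * (2 + j))) (n * j) ⟩
  3 * (n * (2 + j)) + n * j            ≡⟨ regroup n j ⟩
  2 * n * (3 + 2 * j)                  ∎)
  where
  open ≤-Reasoning
  double+ : ∀ j → 2 * (2 + j) ≡ 4 + 2 * j
  double+ = solve-∀
  regroup : ∀ n j → 3 * (n * (2 + j)) + n * j ≡ 2 * n * (3 + 2 * j)
  regroup = solve-∀

proposition2p3 : (n : ℕ) (_+_ : Op₂ (Fin n)) (0g : Fin n) (-_ : Op₁ (Fin n)) →
    IsAbelianGroup _≡_ _+_ 0g -_ →
    (W C : Subset n) → IsMinimalComplement _+_ W C →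
    (∣ C ∣ * (2 * ∣ W ∣ ∸ 1) ≤ n * ∣ W ∣) × (¬ (C ≡ ⊤) → 3 * ∣ C ∣ ≤ 2 * n)
proposition2p3 n _∙_ ε _⁻¹ isAbelianGroup W C minimal = bound , proper⇒bound
  where
  bound : ∣ C ∣ * (2 * ∣ W ∣ ∸ 1) ≤ n * ∣ W ∣
  bound = subst (λ k → ∣ C ∣ * (2 * ∣ W ∣ ∸ 1) ≤ k * ∣ W ∣) (∣p∣+∣∁p∣≡n C)
    (m*k≤m+k*l⇒m*[2k∸1]≤[m+l]*k (∣ C ∣) (∣ W ∣) (∣ ∁ C ∣)
      (∣C∣*∣W∣≤∣C∣+∣W∣*∣∁C∣ isAbelianGroup minimal))
  proper⇒bound : ¬ C ≡ ⊤ → 3 * ∣ C ∣ ≤ 2 * n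
  proper⇒bound C≢⊤ = 2≤k⇒m*[2k∸1]≤n*k⇒3m≤2n (∣ C ∣) n (∣ W ∣) 2≤∣W∣ bound
    where
    2≤∣W∣ : 2 ≤ ∣ W ∣
    2≤∣W∣ = ≰⇒> λ ∣W∣≤1 →
      C≢⊤ (complement-of-subsingleton isAbelianGroup (proj₁ minimal) (∣p∣≤1⇒subsingleton ∣W∣≤1))
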